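{- Let $\mathbf P=(P,\leq)$ be a non-empty poset, $f\colon P\to P$ and $A\subseteq P$. Then: (i) $f$ is monotone if and only if $f(U(x))\subseteq U(f(x))$ for all $x\in P$; (ii) if $f$ is upper cone preserving then $f$ is monotone and $f(F)$ is a filter of $\mathbf P$ for every filter $F$ of $\mathbf P$; (iii) if every monotone mapping from $P$ to $P$ is upper cone preserving then $|P|=1$; (iv) if $f$ is monotone then $f(L(A))\subseteq L(f(A))$ and $f(U(A))\subseteq U(f(A))$.
   Context: For $A\subseteq P$, $U(A)=\{x\in P\mid y\leq x\text{ for all }y\in A\}$ and $L(A)=\{x\in P\mid x\leq y\text{ for all }y\in A\}$; $U(x)=U(\{x\})$, $U(x,y)=U(\{x,y\})$. A filter is a subset $F\subseteq P$ with $x\in F$, $x\leq y$ implying $y\in F$. $f$ is monotone if $x\leq y$ implies $f(x)\leq f(y)$, and upper cone preserving if $f(U(x,y))=U(f(x),f(y))$ for all $x,y\in P$. -}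

module Defs where

open import Level using (Level; _⊔_)
open import Data.Product using (Σ; _×_)
open import Data.Sum using (_⊎_)
open import Relation.Unary using (Pred; _⊆_)
open import Relation.Binary.Bundles using (Poset)

module PosetNotions {c ℓ₁ ℓ₂ : Level} (𝐏 : Poset c ℓ₁ ℓ₂) where
  open Poset 𝐏

  U : ∀ {ℓ} → Pred Carrier ℓ → Pred Carrier (c ⊔ ℓ ⊔ ℓ₂)
  U A x = ∀ y → A y → y ≤ x

  L : ∀ {ℓ} → Pred Carrier ℓ → Pred Carrier (c ⊔ ℓ ⊔ ℓ₂)
  L A x = ∀ y → A y → x ≤ y

  single : Carrier → Pred Carrier ℓ₁
  single x z = z ≈ x

  pair : Carrier → Carrier → Pred Carrier ℓ₁
  pair x y z = (z ≈ x) ⊎ (z ≈ y)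

  U₁ : Carrier → Pred Carrier (c ⊔ ℓ₁ ⊔ ℓ₂)
  U₁ x = U (single x)

  U₂ : Carrier → Carrier → Pred Carrier (c ⊔ ℓ₁ ⊔ ℓ₂)
  U₂ x y = U (pair x y)

  Image : ∀ {ℓ} → (Carrier → Carrier) → Pred Carrier ℓ → Pred Carrier (c ⊔ ℓ ⊔ ℓ₁)
  Image f S y = Σ Carrier (λ x → S x × (y ≈ f x))

  _≐_ : ∀ {ℓ ℓ'} → Pred Carrier ℓ → Pred Carrier ℓ' → Set (c ⊔ ℓ ⊔ ℓ')
  S ≐ T = (S ⊆ T) × (T ⊆ S)

  IsFilter : ∀ {ℓ} → Pred Carrier ℓ → Set (c ⊔ ℓ ⊔ ℓ₂)
  IsFilter F = ∀ x y → F x → x ≤ y → F y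

  Monotone : (Carrier → Carrier) → Set (c ⊔ ℓ₂)
  Monotone f = ∀ x y → x ≤ y → f x ≤ f y

  UpperConePreserving : (Carrier → Carrier) → Set (c ⊔ ℓ₁ ⊔ ℓ₂)
  UpperConePreserving f = ∀ x y → Image f (U₂ x y) ≐ U₂ (f x) (f y)

  IsSingleton : Set (c ⊔ ℓ₁)
  IsSingleton = Σ Carrier (λ x → ∀ y → y ≈ x)

module Submission where

open import Defs
open import Level using (Level)
open import Data.Product using (_×_; _,_; Σ; proj₁; proj₂)
open import Data.Sum using (inj₁; inj₂; [_,_])
open import Function.Base using (const)
open import Function.Bundles using (_⇔_; mk⇔)
open import Relation.Unary using (Pred; _⊆_)
open import Relation.Binary.Bundles using (Poset)

module _ {c ℓ₁ ℓ₂ : Level} (𝐏 : Poset c ℓ₁ ℓ₂) where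
  open Poset 𝐏
  open PosetNotions 𝐏

  U₁-intro : ∀ {x y} → x ≤ y → U₁ x y
  U₁-intro x≤y z z≈x = ≤-respˡ-≈ (Eq.sym z≈x) x≤y

  U₁-elim : ∀ {x y} → U₁ x y → x ≤ y
  U₁-elim y∈U₁x = y∈U₁x _ Eq.refl

  U₂-intro : ∀ {x y z} → x ≤ z → y ≤ z → U₂ x y z
  U₂-intro x≤z y≤z w = [ (λ w≈x → ≤-respˡ-≈ (Eq.sym w≈x) x≤z)
                       , (λ w≈y → ≤-respˡ-≈ (Eq.sym w≈y) y≤z) ]

  U₂-elimˡ : ∀ {x y z} → U₂ x y z → x ≤ z
  U₂-elimˡ z∈U₂ = z∈U₂ _ (inj₁ Eq.refl)

  U₂-elimʳ : ∀ {x y z} → U₂ x y z → y ≤ z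
  U₂-elimʳ z∈U₂ = z∈U₂ _ (inj₂ Eq.refl)

  monotone⇔image-U₁⊆U₁ : ∀ f → Monotone f ⇔ (∀ x → Image f (U₁ x) ⊆ U₁ (f x))
  monotone⇔image-U₁⊆U₁ f = mk⇔ to from
    where
    to : Monotone f → ∀ x → Image f (U₁ x) ⊆ U₁ (f x)
    to mono x (y , y∈U₁x , z≈fy) =
      U₁-intro (≤-respʳ-≈ (Eq.sym z≈fy) (mono x y (U₁-elim y∈U₁x)))

    from : (∀ x → Image f (U₁ x) ⊆ U₁ (f x)) → Monotone f
    from image⊆ x y x≤y = U₁-elim (image⊆ x (y , U₁-intro x≤y , Eq.refl))

  monotone⇒image-L⊆L-image : ∀ {ℓ} {f} (A : Pred Carrier ℓ) →
                             Monotone f → Image f (L A) ⊆ L (Image f A)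
  monotone⇒image-L⊆L-image A mono (x , x∈LA , z≈fx) w (a , a∈A , w≈fa) =
    ≤-respˡ-≈ (Eq.sym z≈fx) (≤-respʳ-≈ (Eq.sym w≈fa) (mono x a (x∈LA a a∈A)))

  monotone⇒image-U⊆U-image : ∀ {ℓ} {f} (A : Pred Carrier ℓ) →
                             Monotone f → Image f (U A) ⊆ U (Image f A)
  monotone⇒image-U⊆U-image A mono (x , x∈UA , z≈fx) w (a , a∈A , w≈fa) =
    ≤-respˡ-≈ (Eq.sym w≈fa) (≤-respʳ-≈ (Eq.sym z≈fx) (mono a x (x∈UA a a∈A)))

  upperConePreserving⇒monotone : ∀ {f} → UpperConePreserving f → Monotone f
  upperConePreserving⇒monotone ucp x y x≤y =
    U₂-elimˡ (proj₁ (ucp x y) (y , U₂-intro x≤y refl , Eq.refl))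

  upperConePreserving⇒image-onto-U₁ : ∀ {f} → UpperConePreserving f →
                                      ∀ {a w} → f a ≤ w → Σ Carrier λ v → a ≤ v × w ≈ f v
  upperConePreserving⇒image-onto-U₁ ucp {a} fa≤w
    with proj₂ (ucp a a) (U₂-intro fa≤w fa≤w)
  ... | v , v∈U₂aa , w≈fv = v , U₂-elimˡ v∈U₂aa , w≈fv

  upperConePreserving⇒image-filter : ∀ {ℓ} {f} → UpperConePreserving f →
                                     (F : Pred Carrier ℓ) → IsFilter F → IsFilter (Image f F)
  upperConePreserving⇒image-filter ucp F filter z w (a , a∈F , z≈fa) z≤w
    with upperConePreserving⇒image-onto-U₁ ucp (≤-respˡ-≈ z≈fa z≤w)
  ... | v , a≤v , w≈fv = v , filter a v a∈F a≤v , w≈fv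

  const-monotone : ∀ a → Monotone (const a)
  const-monotone a _ _ _ = refl

  -- For the constant map at a, cone preservation at (a, a) makes a maximal, and at (x, y)
  -- it forces U(x, y) to be inhabited; a poset that is directed with every element maximal
  -- is a single point.
  const-upperConePreserving⇒maximal : ∀ {a} → UpperConePreserving (const a) →
                                      ∀ {z} → a ≤ z → z ≈ a
  const-upperConePreserving⇒maximal {a} ucp a≤z =
    proj₂ (proj₂ (upperConePreserving⇒image-onto-U₁ ucp {a} a≤z))

  const-upperConePreserving⇒upper-bound : ∀ {a} → UpperConePreserving (const a) →
                                          ∀ x y → Σ Carrier (U₂ x y)
  const-upperConePreserving⇒upper-bound ucp x y
    with proj₂ (ucp x y) (U₂-intro refl refl)
  ... | w , w∈U₂xy , _ = w , w∈U₂xy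

  const-upperConePreserving⇒singleton : Carrier →
                                        (∀ a → UpperConePreserving (const a)) → IsSingleton
  const-upperConePreserving⇒singleton p ucp = p , all≈p
    where
    all≈p : ∀ y → y ≈ p
    all≈p y with const-upperConePreserving⇒upper-bound (ucp p) p y
    ... | w , w∈U₂py = Eq.trans (Eq.sym (w≈ y (U₂-elimʳ w∈U₂py))) (w≈ p (U₂-elimˡ w∈U₂py))
      where
      w≈ : ∀ a → a ≤ w → w ≈ a
      w≈ a = const-upperConePreserving⇒maximal (ucp a)

lemma2p3 : ∀ {c ℓ₁ ℓ₂ ℓ : Level} (𝐏 : Poset c ℓ₁ ℓ₂) → Poset.Carrier 𝐏
    → (f : Poset.Carrier 𝐏 → Poset.Carrier 𝐏) → (A : Pred (Poset.Carrier 𝐏) ℓ)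
    → let open PosetNotions 𝐏 in
      (Monotone f ⇔ (∀ x → Image f (U₁ x) ⊆ U₁ (f x)))
      × (UpperConePreserving f
          → Monotone f × (∀ (F : Pred (Poset.Carrier 𝐏) ℓ) → IsFilter F → IsFilter (Image f F)))
      × ((∀ (g : Poset.Carrier 𝐏 → Poset.Carrier 𝐏) → Monotone g → UpperConePreserving g) → IsSingleton)
      × (Monotone f → (Image f (L A) ⊆ L (Image f A)) × (Image f (U A) ⊆ U (Image f A)))
lemma2p3 𝐏 p f A =
    monotone⇔image-U₁⊆U₁ 𝐏 f
  , (λ ucp → upperConePreserving⇒monotone 𝐏 ucp , upperConePreserving⇒image-filter 𝐏 ucp)
  , (λ allUCP → const-upperConePreserving⇒singleton 𝐏 p
                  (λ a → allUCP (const a) (const-monotone 𝐏 a)))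
  , (λ mono → monotone⇒image-L⊆L-image 𝐏 A mono , monotone⇒image-U⊆U-image 𝐏 A mono)
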